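{- Let $n$ be a positive integer with $\gcd(n,6)=1$ and let $S=(x_1)(x_2)(x_3)(x_4)$ be a minimal zero-sum sequence over $\mathbb{Z}/n$ with integers $1\le x_i<n$. Suppose $\mathrm{ind}(S)=2$, $x_1=1$, $x_2+1=x_3$, and $\gcd(x_i,n)=1$ for all $i$. Then $x_2=n-4$ or $x_2=n-3$; consequently $S=(1)(n-4)(n-3)(6)$ or $S=(1)(n-3)(n-2)(4)$.
   Context: A sequence is minimal zero-sum if its terms sum to $0$ and no proper nontrivial subsequence sums to $0$. For a generator $g$ of $\mathbb{Z}/n$, writing $S=(y_1g)\cdots(y_4g)$ with $1\le y_i\le n$, the $g$-norm is $\|S\|_g=\frac{1}{n}\sum y_i$, and $\mathrm{ind}(S)=\min_g\|S\|_g$ over all generators $g$. -}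

module Defs where

open import Data.Nat using (ℕ; zero; suc; _+_; _*_; _≤_; _<_; NonZero)
open import Data.Nat.DivMod using (_%_)
open import Data.Nat.GCD using (gcd)
open import Data.Fin using (Fin)
open import Data.Vec using (Vec; []; _∷_; lookup; sum)
open import Data.Fin.Subset using (Subset; ⊤; Nonempty; inside; outside)
open import Data.Product using (Σ; _×_; ∃)
open import Relation.Binary.PropositionalEquality using (_≡_; _≢_)
open import Relation.Nullary using (¬_)

subSum : ∀ {k} → Subset k → Vec ℕ k → ℕ
subSum []            []       = 0
subSum (inside ∷ p)  (x ∷ xs) = x + subSum p xs
subSum (outside ∷ p) (x ∷ xs) = subSum p xs

ZeroSum : ∀ {k} (n : ℕ) → .{{NonZero n}} → Vec ℕ k → Set
ZeroSum n xs = sum xs % n ≡ 0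

MinimalZeroSum : ∀ {k} (n : ℕ) → .{{NonZero n}} → Vec ℕ k → Set
MinimalZeroSum {k} n xs =
  ZeroSum n xs ×
  ((p : Subset k) → Nonempty p → p ≢ ⊤ → ¬ (subSum p xs % n ≡ 0))

IsGenerator : (n g : ℕ) → Set
IsGenerator n g = g < n × gcd g n ≡ 1

-- n · ‖S‖_g = s : there are y_i with 1 ≤ y_i ≤ n, y_i g = x_i in ℤ/n, Σ y_i = s.
-- (For a generator g the y_i are unique.)
ScaledNorm : ∀ {k} (n : ℕ) → .{{NonZero n}} → ℕ → Vec ℕ k → ℕ → Set
ScaledNorm {k} n g xs s =
  Σ (Vec ℕ k) λ ys →
    ((i : Fin k) → 1 ≤ lookup ys i × lookup ys i ≤ n ×
                   (lookup ys i * g) % n ≡ lookup xs i % n) ×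
    sum ys ≡ s

-- ind(S) = m  (m a natural number): min over generators g of ‖S‖_g equals m,
-- i.e. the minimum of n·‖S‖_g over generators is m·n.
IndexIs : ∀ {k} (n : ℕ) → .{{NonZero n}} → Vec ℕ k → ℕ → Set
IndexIs n xs m =
  (∃ λ g → IsGenerator n g × ScaledNorm n g xs (m * n)) ×
  (∀ g s → IsGenerator n g → ScaledNorm n g xs s → m * n ≤ s)

-- The generators 1 and -1 have norms Σ xᵢ and 4n - Σ xᵢ (scaled by n), so ind(S) = 2 forces
-- Σ xᵢ = 2n; writing x₃ = n - c this gives x₄ = 2c. For c = 1 the terms x₁, x₃ would form a
-- zero-sum subsequence, and c = 2, 3 are the two cases of the conclusion. For c ≥ 4 we have
-- 2c + 3 ≤ n (n is odd and 1 + x₄ ≢ 0), and the numbers 2, 3, 4, 6, 8, 12, … grow by ratios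
-- at most 3/2 < 2c/(c + 1), so one of them, m, satisfies (c + 1) m < n < 2 c m. As gcd(n, 6) = 1,
-- m is invertible, and w.r.t. the generator m⁻¹ the sequence has coefficients
-- (m, n - (c + 1) m, n - c m, 2 c m - n), whose sum is n: the index would be 1.

module Submission where

open import Defs
open import Data.Nat
open import Data.Nat.Properties
open import Data.Nat.DivMod
open import Data.Nat.Divisibility
open import Data.Nat.GCD using (gcd; gcd[m,n]∣m; gcd[m,n]∣n; module Bézout)
open import Data.Nat.Coprimality as Coprimality using (Coprime; gcd≡1⇒coprime; coprime-Bézout)
open import Data.Nat.Tactic.RingSolver using (solve-∀)
open import Data.Fin using (zero)
open import Data.Fin.Subset using (Subset; Nonempty; ⊤; inside; outside)
open import Data.Vec using (Vec; []; _∷_; here; map; sum)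
open import Data.Vec.Relation.Unary.All as All using (All; []; _∷_)
open import Data.Vec.Relation.Binary.Pointwise.Inductive as Pointwise using (Pointwise; []; _∷_)
open import Data.Product using (∃; _×_; _,_)
open import Data.Sum using (_⊎_; inj₁; inj₂)
open import Data.Empty using (⊥-elim)
open import Function using (_∘_; _$_)
open import Relation.Nullary using (¬_; yes; no)
open import Relation.Binary.PropositionalEquality

private
  variable
    a b c m n x y : ℕ

%-*-cong : .{{_ : NonZero n}} → a % n ≡ b % n → c % n ≡ m % n → (a * c) % n ≡ (b * m) % n
%-*-cong {n} {a} {b} {c} {m} a≡b c≡m = begin
  (a * c) % n             ≡⟨ %-distribˡ-* a c n ⟩
  ((a % n) * (c % n)) % n ≡⟨ cong₂ (λ s t → (s * t) % n) a≡b c≡m ⟩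
  ((b % n) * (m % n)) % n ≡⟨ %-distribˡ-* b m n ⟨
  (b * m) % n             ∎
  where open ≡-Reasoning

record Invertible (n : ℕ) .{{_ : NonZero n}} (m : ℕ) : Set where
  constructor _,_
  field
    inverse : ℕ
    cancels : (m * inverse) % n ≡ 1 % n

invertible-* : .{{_ : NonZero n}} → Invertible n a → Invertible n b → Invertible n (a * b)
invertible-* {n} {a} {b} (g , ag≡1) (h , bh≡1) = g * h , (begin
  (a * b * (g * h)) % n   ≡⟨ cong (_% n) (interchange a b g h) ⟩
  (a * g * (b * h)) % n   ≡⟨ %-*-cong ag≡1 bh≡1 ⟩
  1 % n                   ∎)
  where
  open ≡-Reasoning
  interchange : ∀ a b g h → a * b * (g * h) ≡ a * g * (b * h)
  interchange = solve-∀

coprime⇒invertible : .{{_ : NonZero n}} → Coprime m n → Invertible n m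
coprime⇒invertible {n@(suc p)} {m} coprime with coprime-Bézout coprime
... | Bézout.+- x y 1+yn≡xm = x , (begin
  (m * x) % n     ≡⟨ cong (_% n) (trans (*-comm m x) (sym 1+yn≡xm)) ⟩
  (1 + y * n) % n ≡⟨ [m+kn]%n≡m%n 1 y n ⟩
  1 % n           ∎)
  where open ≡-Reasoning
-- Here m x ≡ -1, and -1 ≡ p is its own inverse, so x p inverts m.
... | Bézout.-+ x y 1+xm≡yn = x * p , (begin
  (m * (x * p)) % n         ≡⟨ [m+kn]%n≡m%n (m * (x * p)) 1 n ⟨
  (m * (x * p) + 1 * n) % n ≡⟨ cong (_% n) (expand m x p) ⟩
  (1 + (1 + x * m) * p) % n ≡⟨ cong (λ t → (1 + t * p) % n) 1+xm≡yn ⟩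
  (1 + y * n * p) % n       ≡⟨ cong (λ t → (1 + t) % n) (swap y n p) ⟩
  (1 + y * p * n) % n       ≡⟨ [m+kn]%n≡m%n 1 (y * p) n ⟩
  1 % n                     ∎)
  where
  open ≡-Reasoning
  expand : ∀ m x p → m * (x * p) + 1 * suc p ≡ 1 + (1 + x * m) * p
  expand = solve-∀
  swap : ∀ y n p → y * n * p ≡ y * p * n
  swap = solve-∀

pred-selfInverse : ∀ n .{{_ : NonZero n}} → ((n ∸ 1) * (n ∸ 1)) % n ≡ 1 % n
pred-selfInverse (suc zero)    = refl
pred-selfInverse (suc (suc r)) =
  trans (cong (_% suc (suc r)) (square r)) ([m+kn]%n≡m%n 1 r (suc (suc r)))
  where
  square : ∀ r → suc r * suc r ≡ 1 + r * suc (suc r)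
  square = solve-∀

inverse⇒gcd≡1 : ∀ {g} .{{_ : NonZero n}} → 1 < n → (m * g) % n ≡ 1 % n → gcd (g % n) n ≡ 1
inverse⇒gcd≡1 {n} {m} {g} 1<n mg≡1 = ∣1⇒≡1 (subst (d ∣_) (trans mg≡1 (m<n⇒m%n≡m 1<n)) d∣mg%n)
  where
  d = gcd (g % n) n
  d∣g : d ∣ g
  d∣g = ∣n∣m%n⇒∣m (gcd[m,n]∣n (g % n) n) (gcd[m,n]∣m (g % n) n)
  d∣mg%n : d ∣ (m * g) % n
  d∣mg%n = %-presˡ-∣ (∣n⇒∣m*n m d∣g) (gcd[m,n]∣n (g % n) n)

-- y ∈ [1, n] represents m x in ℤ/n; with g = m⁻¹ these y are the paper's y_i for x_i = y_i g.
record Coefficient (n m x y : ℕ) : Set where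
  constructor coefficient
  field
    positive : 1 ≤ y
    bounded  : y ≤ n
    quotient : ℕ
    equation : m * x ≡ y + quotient * n

coefficient-congruence : ∀ {g} .{{_ : NonZero n}} → Coefficient n m x y →
                         (m * g) % n ≡ 1 % n → (y * (g % n)) % n ≡ x % n
coefficient-congruence {n} {m} {x} {y} {g} (coefficient _ _ k mx≡y+kn) mg≡1 = begin
  (y * (g % n)) % n       ≡⟨ %-*-cong {a = y} {c = g % n} refl (m%n%n≡m%n g n) ⟩
  (y * g) % n             ≡⟨ [m+kn]%n≡m%n (y * g) (k * g) n ⟨
  (y * g + k * g * n) % n ≡⟨ cong (_% n) (factor y g k n) ⟩
  ((y + k * n) * g) % n   ≡⟨ cong (λ t → (t * g) % n) mx≡y+kn ⟨
  (m * x * g) % n         ≡⟨ cong (_% n) (reassociate m x g) ⟩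
  (x * (m * g)) % n       ≡⟨ %-*-cong {a = x} refl mg≡1 ⟩
  (x * 1) % n             ≡⟨ cong (_% n) (*-identityʳ x) ⟩
  x % n                   ∎
  where
  open ≡-Reasoning
  factor : ∀ y g k n → y * g + k * g * n ≡ (y + k * n) * g
  factor = solve-∀
  reassociate : ∀ m x g → m * x * g ≡ x * (m * g)
  reassociate = solve-∀

coefficient-exact : m * x ≡ y → 1 ≤ y → y ≤ n → Coefficient n m x y
coefficient-exact mx≡y 1≤y y≤n = coefficient 1≤y y≤n 0 (trans mx≡y (sym (+-identityʳ _)))

coefficient-wrap : n + y ≡ m * x → 1 ≤ y → y ≤ n → Coefficient n m x y
coefficient-wrap {n} {y} n+y≡mx 1≤y y≤n =
  coefficient 1≤y y≤n 1 (trans (sym n+y≡mx) (trans (+-comm n y) (cong (y +_) (sym (+-identityʳ n)))))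

-- x ≡ -a, so m x ≡ -a m ≡ y.
coefficient-complement : ∀ {a j} → x + a ≡ n → a * suc j + y ≡ n → 1 ≤ y →
                         Coefficient n (suc j) x y
coefficient-complement {x} {n} {y} {a} {j} x+a≡n am+y≡n 1≤y =
  coefficient 1≤y (subst (y ≤_) am+y≡n (m≤n+m y (a * suc j))) j $
  +-cancelʳ-≡ (a * suc j) _ _ (begin
    suc j * x + a * suc j ≡⟨ distribute j x a ⟩
    suc j * (x + a)       ≡⟨ cong (suc j *_) x+a≡n ⟩
    n + j * n             ≡⟨ cong (_+ j * n) am+y≡n ⟨
    a * suc j + y + j * n ≡⟨ rearrange a j y n ⟩
    y + j * n + a * suc j ∎)
  where
  open ≡-Reasoning
  distribute : ∀ j x a → suc j * x + a * suc j ≡ suc j * (x + a)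
  distribute = solve-∀
  rearrange : ∀ a j y n → a * suc j + y + j * n ≡ y + j * n + a * suc j
  rearrange = solve-∀

coefficient-negate : x + y ≡ n → 1 ≤ x → 1 ≤ y → Coefficient n (n ∸ 1) x y
coefficient-negate {suc x} {y} refl _ 1≤y = coefficient 1≤y (m≤n+m y (suc x)) x (expand x y)
  where
  expand : ∀ x y → (x + y) * suc x ≡ y + x * suc (x + y)
  expand = solve-∀

NormLowerBound : ∀ {k} (n : ℕ) → .{{NonZero n}} → Vec ℕ k → ℕ → Set
NormLowerBound n xs b = ∀ g s → IsGenerator n g → ScaledNorm n g xs s → b ≤ s

≤-sum-coefficients : ∀ {k} {xs ys : Vec ℕ k} .{{_ : NonZero n}} → NormLowerBound n xs b → 1 < n →
                     Invertible n m → Pointwise (Coefficient n m) xs ys → b ≤ sum ys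
≤-sum-coefficients {n} {m = m} {ys = ys} lower 1<n (g , mg≡1) coefficients =
  lower (g % n) (sum ys) (m%n<n g n , inverse⇒gcd≡1 {m = m} 1<n mg≡1) (ys , entry ∘ Pointwise.lookup coefficients , refl)
  where
  entry : Coefficient n m x y → 1 ≤ y × y ≤ n × (y * (g % n)) % n ≡ x % n
  entry c = Coefficient.positive c , Coefficient.bounded c , coefficient-congruence c mg≡1

sum-complement : ∀ {k} {xs : Vec ℕ k} → All (_≤ n) xs → sum (map (n ∸_) xs) + sum xs ≡ k * n
sum-complement []                       = refl
sum-complement {n} {suc k} {x ∷ xs} (x≤n ∷ xs≤n) = begin
  (n ∸ x + sum (map (n ∸_) xs)) + (x + sum xs) ≡⟨ interchange (n ∸ x) _ x (sum xs) ⟩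
  (n ∸ x + x) + (sum (map (n ∸_) xs) + sum xs) ≡⟨ cong₂ _+_ (m∸n+n≡m x≤n) (sum-complement xs≤n) ⟩
  n + k * n                                    ∎
  where
  open ≡-Reasoning
  interchange : ∀ a b c d → (a + b) + (c + d) ≡ (a + c) + (b + d)
  interchange = solve-∀

sum≡half-bound : ∀ i (xs : Vec ℕ (2 * i)) .{{_ : NonZero n}} → 1 < n →
                 All (λ x → 1 ≤ x × x < n) xs → NormLowerBound n xs (i * n) → sum xs ≡ i * n
sum≡half-bound {n} i xs 1<n bounds lower = ≤-antisym sum≤in (≤-sum-coefficients lower 1<n (1 , refl) (ones bounds))
  where
  ones : ∀ {k} {xs : Vec ℕ k} → All (λ x → 1 ≤ x × x < n) xs → Pointwise (Coefficient n 1) xs xs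
  ones []                  = []
  ones ((1≤x , x<n) ∷ bs) = coefficient-exact (*-identityˡ _) 1≤x (<⇒≤ x<n) ∷ ones bs
  negations : ∀ {k} {xs : Vec ℕ k} → All (λ x → 1 ≤ x × x < n) xs →
              Pointwise (Coefficient n (n ∸ 1)) xs (map (n ∸_) xs)
  negations []                  = []
  negations ((1≤x , x<n) ∷ bs) = coefficient-negate (m+[n∸m]≡n (<⇒≤ x<n)) 1≤x (m<n⇒0<n∸m x<n) ∷ negations bs
  in≤negated : i * n ≤ sum (map (n ∸_) xs)
  in≤negated = ≤-sum-coefficients lower 1<n (n ∸ 1 , pred-selfInverse n) (negations bounds)
  sum≤in : sum xs ≤ i * n
  sum≤in = +-cancelˡ-≤ (i * n) _ _ (begin
    i * n + sum xs                   ≤⟨ +-monoˡ-≤ (sum xs) in≤negated ⟩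
    sum (map (n ∸_) xs) + sum xs     ≡⟨ sum-complement (All.map (λ (_ , x<n) → <⇒≤ x<n) bounds) ⟩
    2 * i * n                        ≡⟨ double i n ⟩
    i * n + i * n                    ∎)
    where
    open ≤-Reasoning
    double : ∀ i n → 2 * i * n ≡ i * n + i * n
    double = solve-∀

crossing : ∀ (lo hi : ℕ → ℕ) → (∀ i → lo (suc i) ≤ hi i) → lo 0 < n →
           ∀ N → n ≤ hi N → ∃ λ i → lo i < n × n ≤ hi i
crossing lo hi step lo₀<n zero n≤hi₀ = 0 , lo₀<n , n≤hi₀
crossing {n} lo hi step lo₀<n (suc N) n≤hi₁₊ₙ with n ≤? hi N
... | yes n≤hiₙ = crossing lo hi step lo₀<n N n≤hiₙ
... | no  n≰hiₙ = suc N , ≤-<-trans (step N) (≰⇒> n≰hiₙ) , n≤hi₁₊ₙ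

threeSmooth : ℕ → ℕ
threeSmooth 0             = 2
threeSmooth 1             = 3
threeSmooth (suc (suc i)) = 2 * threeSmooth i

threeSmooth-ratio : ∀ i → threeSmooth (suc i) * 2 ≤ threeSmooth i * 3
threeSmooth-ratio 0             = ≤-refl
threeSmooth-ratio 1             = n≤1+n 8
threeSmooth-ratio (suc (suc i)) = begin
  2 * threeSmooth (suc i) * 2   ≡⟨ *-assoc 2 (threeSmooth (suc i)) 2 ⟩
  2 * (threeSmooth (suc i) * 2) ≤⟨ *-monoʳ-≤ 2 (threeSmooth-ratio i) ⟩
  2 * (threeSmooth i * 3)       ≡⟨ *-assoc 2 (threeSmooth i) 3 ⟨
  2 * threeSmooth i * 3         ∎
  where open ≤-Reasoning

threeSmooth-< : ∀ i → threeSmooth i < threeSmooth (suc i)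
threeSmooth-< 0             = n<1+n 2
threeSmooth-< 1             = n<1+n 3
threeSmooth-< (suc (suc i)) = *-monoʳ-< 2 (threeSmooth-< i)

threeSmooth-≥ : ∀ i → i ≤ threeSmooth i
threeSmooth-≥ zero    = z≤n
threeSmooth-≥ (suc i) = ≤-<-trans (threeSmooth-≥ i) (threeSmooth-< i)

threeSmooth-invertible : .{{_ : NonZero n}} → Invertible n 2 → Invertible n 3 →
                         ∀ i → Invertible n (threeSmooth i)
threeSmooth-invertible inv₂ inv₃ 0             = inv₂
threeSmooth-invertible inv₂ inv₃ 1             = inv₃
threeSmooth-invertible inv₂ inv₃ (suc (suc i)) = invertible-* inv₂ (threeSmooth-invertible inv₂ inv₃ i)

ratio-step : ∀ {a b} → 3 ≤ c → a * 2 ≤ b * 3 → suc c * a ≤ 2 * c * b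
ratio-step {c} {a} {b} 3≤c a2≤b3 = *-cancelʳ-≤ _ _ 2 (begin
  suc c * a * 2       ≡⟨ *-assoc (suc c) a 2 ⟩
  suc c * (a * 2)     ≤⟨ *-monoʳ-≤ (suc c) a2≤b3 ⟩
  suc c * (b * 3)     ≡⟨ expand c b ⟩
  (3 + 3 * c) * b     ≤⟨ *-monoˡ-≤ b (+-monoˡ-≤ (3 * c) 3≤c) ⟩
  (c + 3 * c) * b     ≡⟨ collect c b ⟩
  2 * c * b * 2       ∎)
  where
  open ≤-Reasoning
  expand : ∀ c b → suc c * (b * 3) ≡ (3 + 3 * c) * b
  expand = solve-∀
  collect : ∀ c b → (c + 3 * c) * b ≡ 2 * c * b * 2
  collect = solve-∀

threeSmooth-crossing : 3 ≤ c → 3 + 2 * c ≤ n →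
                       ∃ λ i → suc c * threeSmooth i < n × n ≤ 2 * c * threeSmooth i
threeSmooth-crossing {c} {n} 3≤c@(s≤s _) 3+2c≤n =
  crossing (λ i → suc c * threeSmooth i) (λ i → 2 * c * threeSmooth i)
           (λ i → ratio-step {a = threeSmooth (suc i)} 3≤c (threeSmooth-ratio i)) start n reach
  where
  start : suc c * 2 < n
  start = ≤-trans (≤-reflexive (cong (3 +_) (*-comm c 2))) 3+2c≤n
  reach : n ≤ 2 * c * threeSmooth n
  reach = ≤-trans (threeSmooth-≥ n) (m≤n*m (threeSmooth n) (2 * c))

multiplier⇒bound≤n : .{{_ : NonZero n}} → 1 < n → NormLowerBound n (1 ∷ x ∷ x + 1 ∷ 2 * c ∷ []) b →
                     Invertible n m → x + 1 + c ≡ n → suc c * m < n → n < 2 * c * m → b ≤ n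
multiplier⇒bound≤n {c = c} {m = zero} _ _ _ _ _ n<0 =
  ⊥-elim (<⇒≱ n<0 (≤-trans (≤-reflexive (*-zeroʳ (2 * c))) z≤n))
multiplier⇒bound≤n {n} {x} {c} {b} {m@(suc j)} 1<n lower inv gap lo hi
  with w , lo-gap ← m≤n⇒∃[o]m+o≡n lo | w′ , hi-gap ← m≤n⇒∃[o]m+o≡n hi =
  subst (b ≤_) (norm≡n e₂ e₄) (≤-sum-coefficients lower 1<n inv (c₁ ∷ c₂ ∷ c₃ ∷ c₄ ∷ []))
  where
  double : ∀ c m → 2 * c * m ≡ c * m + c * m
  double = solve-∀
  shift : ∀ c m w → c * m + (w + m) ≡ suc c * m + w
  shift = solve-∀
  gather : ∀ m y₂ y₄ n → m + (y₂ + (y₂ + m + (y₄ + 0))) + n ≡ 2 * m + 2 * y₂ + (n + y₄)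
  gather = solve-∀
  regroup : ∀ m y₂ c → 2 * m + 2 * y₂ + 2 * c * m ≡ (suc c * m + y₂) + (suc c * m + y₂)
  regroup = solve-∀
  e₂ : suc c * m + suc w ≡ n
  e₂ = trans (+-suc _ w) lo-gap
  e₄ : n + suc w′ ≡ 2 * c * m
  e₄ = trans (+-suc n w′) hi-gap
  cm<n : c * m < n
  cm<n = ≤-<-trans (m≤n+m (c * m) m) lo
  w′<n : suc w′ < n
  w′<n = +-cancelˡ-< n (suc w′) n (subst (_< n + n) (sym (trans e₄ (double c m))) (+-mono-< cm<n cm<n))
  c₁ : Coefficient n m 1 m
  c₁ = coefficient-exact (*-identityʳ m) (s≤s z≤n) (<⇒≤ (≤-<-trans (m≤m+n m (c * m)) lo))
  c₂ : Coefficient n m x (suc w)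
  c₂ = coefficient-complement (trans (sym (+-assoc x 1 c)) gap) e₂ (s≤s z≤n)
  c₃ : Coefficient n m (x + 1) (suc w + m)
  c₃ = coefficient-complement gap (trans (shift c m (suc w)) e₂) (s≤s z≤n)
  c₄ : Coefficient n m (2 * c) (suc w′)
  c₄ = coefficient-wrap (trans e₄ (*-comm (2 * c) m)) (s≤s z≤n) (<⇒≤ w′<n)
  norm≡n : ∀ {y₂ y₄} → suc c * m + y₂ ≡ n → n + y₄ ≡ 2 * c * m → m + (y₂ + (y₂ + m + (y₄ + 0))) ≡ n
  norm≡n {y₂} {y₄} e₂ e₄ = +-cancelʳ-≡ n _ _ (begin
    m + (y₂ + (y₂ + m + (y₄ + 0))) + n  ≡⟨ gather m y₂ y₄ n ⟩
    2 * m + 2 * y₂ + (n + y₄)           ≡⟨ cong (2 * m + 2 * y₂ +_) e₄ ⟩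
    2 * m + 2 * y₂ + 2 * c * m          ≡⟨ regroup m y₂ c ⟩
    (suc c * m + y₂) + (suc c * m + y₂) ≡⟨ cong₂ _+_ e₂ e₂ ⟩
    n + n                               ∎)
    where open ≡-Reasoning

coprime-6⇒¬2∣ : Coprime n 6 → ¬ 2 ∣ n
coprime-6⇒¬2∣ coprime 2∣n with () ← coprime (2∣n , divides 3 refl)

coprime-6⇒invertible : .{{_ : NonZero n}} → Coprime n 6 → m ∣ 6 → Invertible n m
coprime-6⇒invertible coprime m∣6 =
  coprime⇒invertible (Coprimality.sym (λ (d∣n , d∣m) → coprime (d∣n , ∣-trans d∣m m∣6)))

wide-gap⇒bound≤n : .{{_ : NonZero n}} → Coprime n 6 → 1 < n →
                   NormLowerBound n (1 ∷ x ∷ x + 1 ∷ 2 * c ∷ []) b →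
                   x + 1 + c ≡ n → 3 ≤ c → 3 + 2 * c ≤ n → b ≤ n
wide-gap⇒bound≤n {n} {c = c} coprime 1<n lower gap 3≤c 3+2c≤n
  with i , lo , hi ← threeSmooth-crossing 3≤c 3+2c≤n =
  multiplier⇒bound≤n 1<n lower (threeSmooth-invertible inv₂ inv₃ i) gap lo
    (≤∧≢⇒< hi (λ n≡2cm → coprime-6⇒¬2∣ coprime (subst (2 ∣_) (sym n≡2cm) (∣m⇒∣m*n _ (m∣m*n c)))))
  where
  inv₂ = coprime-6⇒invertible coprime (divides 3 refl)
  inv₃ = coprime-6⇒invertible coprime (divides 2 refl)

odd-gap : ∀ c → ¬ 2 ∣ n → 2 * c < n → suc (2 * c) ≢ n → 3 + 2 * c ≤ n
odd-gap c odd 2c<n 2c+1≢n =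
  ≤∧≢⇒< (≤∧≢⇒< 2c<n 2c+1≢n) (λ 2c+2≡n → odd (subst (2 ∣_) 2c+2≡n (∣m∣n⇒∣m+n ∣-refl (m∣m*n c))))

minimal⇒subSum≢n : ∀ {k} {xs : Vec ℕ k} {p : Subset k} .{{_ : NonZero n}} →
                   MinimalZeroSum n xs → Nonempty p → p ≢ ⊤ → subSum p xs ≢ n
minimal⇒subSum≢n {n} (_ , minimal) nonempty p≢⊤ sum≡n =
  minimal _ nonempty p≢⊤ (trans (cong (_% n) sum≡n) (n%n≡0 n))

last-term : ∀ x c → 1 + (x + (x + 1 + (y + 0))) ≡ 2 * n → x + 1 + c ≡ n → y ≡ 2 * c
last-term {y} x c sum≡2n refl = +-cancelˡ-≡ (2 + 2 * x) y (2 * c) (begin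
  2 + 2 * x + y                 ≡⟨ lhs x y ⟩
  1 + (x + (x + 1 + (y + 0)))   ≡⟨ sum≡2n ⟩
  2 * (x + 1 + c)               ≡⟨ rhs x c ⟩
  2 + 2 * x + 2 * c             ∎)
  where
  open ≡-Reasoning
  lhs : ∀ x y → 2 + 2 * x + y ≡ 1 + (x + (x + 1 + (y + 0)))
  lhs = solve-∀
  rhs : ∀ x c → 2 * (x + 1 + c) ≡ 2 + 2 * x + 2 * c
  rhs = solve-∀

gap⇒∸ : x + 1 + c ≡ n → x ≡ n ∸ (1 + c) × x + 1 ≡ n ∸ c
gap⇒∸ {x} {c} refl =
  sym (trans (cong (_∸ (1 + c)) (+-assoc x 1 c)) (m+n∸n≡m x (1 + c))) , sym (m+n∸n≡m (x + 1) c)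

proposition2 : (n : ℕ) → .{{_ : NonZero n}} → gcd n 6 ≡ 1 →
    (x₁ x₂ x₃ x₄ : ℕ) →
    1 ≤ x₁ → x₁ < n → 1 ≤ x₂ → x₂ < n → 1 ≤ x₃ → x₃ < n → 1 ≤ x₄ → x₄ < n →
    MinimalZeroSum n (x₁ ∷ x₂ ∷ x₃ ∷ x₄ ∷ []) →
    IndexIs n (x₁ ∷ x₂ ∷ x₃ ∷ x₄ ∷ []) 2 →
    x₁ ≡ 1 → x₂ + 1 ≡ x₃ →
    gcd x₁ n ≡ 1 → gcd x₂ n ≡ 1 → gcd x₃ n ≡ 1 → gcd x₄ n ≡ 1 →
    (x₂ ≡ n ∸ 4 ⊎ x₂ ≡ n ∸ 3) ×
    ((x₁ ≡ 1 × x₂ ≡ n ∸ 4 × x₃ ≡ n ∸ 3 × x₄ ≡ 6) ⊎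
     (x₁ ≡ 1 × x₂ ≡ n ∸ 3 × x₃ ≡ n ∸ 2 × x₄ ≡ 4))
proposition2 n gcd≡1 .1 x₂ .(x₂ + 1) x₄ l₁ 1<n l₂ x₂<n l₃ x₃<n l₄ x₄<n minimal (_ , lower) refl refl _ _ _ _
  with sum≡half-bound 2 (1 ∷ x₂ ∷ x₂ + 1 ∷ x₄ ∷ []) 1<n
                   ((l₁ , 1<n) ∷ (l₂ , x₂<n) ∷ (l₃ , x₃<n) ∷ (l₄ , x₄<n) ∷ []) lower
     | m≤n⇒∃[o]m+o≡n (<⇒≤ x₃<n)
... | sum≡2n | 0 , gap = ⊥-elim (<-irrefl (trans (sym (+-identityʳ (x₂ + 1))) gap) x₃<n)
... | sum≡2n | 1 , gap =
  ⊥-elim (minimal⇒subSum≢n {p = inside ∷ outside ∷ inside ∷ outside ∷ []} minimal (zero , here) (λ ())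
            (trans (cong suc (+-identityʳ (x₂ + 1))) (trans (+-comm 1 (x₂ + 1)) gap)))
... | sum≡2n | 2 , gap =
  let (x₂≡ , x₃≡) = gap⇒∸ gap in inj₂ x₂≡ , inj₂ (refl , x₂≡ , x₃≡ , last-term x₂ 2 sum≡2n gap)
... | sum≡2n | 3 , gap =
  let (x₂≡ , x₃≡) = gap⇒∸ gap in inj₁ x₂≡ , inj₁ (refl , x₂≡ , x₃≡ , last-term x₂ 3 sum≡2n gap)
... | sum≡2n | c@(suc (suc (suc (suc _)))) , gap with refl ← last-term x₂ c sum≡2n gap =
  ⊥-elim (<⇒≱ n<2n (wide-gap⇒bound≤n coprime 1<n lower gap (s≤s (s≤s (s≤s z≤n))) 3+2c≤n))
  where
  coprime : Coprime n 6
  coprime = gcd≡1⇒coprime gcd≡1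
  n<2n : n < 2 * n
  n<2n = subst (n <_) (*-comm n 2) (m<m*n n 2 ≤-refl)
  2c+1≢n : suc (2 * c) ≢ n
  2c+1≢n = minimal⇒subSum≢n {p = inside ∷ outside ∷ outside ∷ inside ∷ []} minimal (zero , here) (λ ())
           ∘ trans (cong suc (+-identityʳ (2 * c)))
  3+2c≤n : 3 + 2 * c ≤ n
  3+2c≤n = odd-gap c (coprime-6⇒¬2∣ coprime) x₄<n 2c+1≢n
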